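{- Let $\mathcal N$ be a bounded DPN with transitions $T$, labelling $\ell$, initial marking $M_I$ and final marking $M_F$, let $\mathcal B=\langle B,b_I,\mathcal A,\Delta,\{b_F\},V,\alpha_I,\mathit{guard}\rangle$ be the DDS obtained from $\mathcal N$ (so $b_I=M_I$, $b_F=M_F$, and states of $B$ are markings), and let $CG_{\mathcal B}=\langle S,s_0,\gamma\rangle$ be its constraint graph from $(b_I,C_{\alpha_I})$. Then: (1) there is a node $(b,\phi)\in S$ with $b\neq b_F$ such that $\mathit{blocked}(b,\phi)$ is satisfiable if and only if $\mathcal B$ has a blocked state; (2) there is a transition $t\in T$ such that no edge $(s,\ell(t),s')\in\gamma$ exists for any $s,s'$ if and only if $\mathcal N$ has a transition $t$ such that $(b,\ell(t),b')\in\Delta$ is unreachable in $\mathcal B$ for all $b,b'\in B$; (3) there is a node $(b,\phi)\in S$ whose state $b$ is a marking $M$ with $M\geq M_F$ if and only if some $b\in B$ which is a marking $M$ with $M\geq M_F$ is reachable in $\mathcal B$.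
   Context: DPN: $\mathcal N=\langle P,T,F,\ell,\mathcal A,V,\mathit{guard}\rangle$ with places $P$, transitions $T$, flow $F:(P\times T)\cup(T\times P)\to\mathbb N$, labelling $\ell:T\to\mathcal A$, typed variables $V$ (types bool, int, rat with domains $\mathbb B,\mathbb Z,\mathbb Q$), and $\mathit{guard}(t)$ a constraint (conjunction of boolean atoms and comparisons $\neq,=,\geq,>$ of linear integer or rational expressions) over $V^r\cup V^w$, disjoint read/written copies of $V$; initial marking $M_I$, initial assignment $\alpha_I$, final marking $M_F$; bounded means at most $k$ tokens per place in reachable markings for some $k$. Its DDS: states are markings with at most $k$ tokens per place, initial state $M_I$, final states $\{M_F\}$, $(M,a,M')\in\Delta$ iff some $t$ with $\ell(t)=a$ has $M(p)\geq F(p,t)$ and $M'(p)=M(p)-F(p,t)+F(t,p)$ for all $p$, and the guard of action $\ell(t)$ is $\mathit{guard}(t)$. DDS semantics: for a DDS $\langle B,b_I,\mathcal A,\Delta,B_F,V,\alpha_I,\mathit{guard}\rangle$ with $\mathit{write}(a)=\{v\mid v^w$ occurs in $\mathit{guard}(a)\}$, a step $(b,\alpha)\xrightarrow{a,\beta}(b',\alpha')$ holds if $(b,a,b')\in\Delta$, $\beta$ assigns $V^r\cup V^w$ with $\beta(v^r)=\alpha(v)$ for all $v$, $\beta\models\mathit{guard}(a)$, and $\alpha'(v)=\beta(v^w)$ for $v\in\mathit{write}(a)$, $\alpha'(v)=\alpha(v)$ otherwise. Derivations are finite step sequences, runs are derivations from $(b_I,\alpha_I)$. A state $b$ (transition $(b,a,b')$)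 is reachable if some run reaches $b$ (takes that transition). $\mathcal B$ has a blocked state if some run reaches $(b,\alpha)$ from which no derivation reaches a configuration with a final state. Constraint graphs: $\Delta_a=\mathit{guard}(a)\wedge\bigwedge_{v\notin\mathit{write}(a)}v^w=v^r$; $\mathit{update}(\phi,a)$ is a quantifier-free formula equivalent to $\exists\vec U.\,\phi[\vec U/\vec V]\wedge\Delta_a[\vec U/\vec V^r,\vec V/\vec V^w]$ with $\vec U$ a fresh copy of $\vec V$. $C_\alpha=\bigwedge_{v\in V}v=\alpha(v)$. A constraint graph from initial node $(b_0,\chi)$ is the least graph with nodes $(b,\phi)$ containing $(b_0,\chi)$ such that whenever $(b,\phi)$ is a node, $(b,a,b')\in\Delta$ and $\mathit{update}(\phi,a)$ is satisfiable, there is a node $(b',\phi')$ with $\phi'\equiv\mathit{update}(\phi,a)$ and an edge $(b,\phi)\xrightarrow{a}(b',\phi')$. $CG_{\mathcal B}$ has initial node $(b_I,C_{\alpha_I})$. For $b\in B$, with fresh variables $V_0=\{v_0\mid v\in V\}$, $CG_{\mathcal B}(b)$ has initial node $(b,\bigwedge_{v\in V}v=v_0)$; let $\mathit{final}(b)$ be the set of formulas $\psi$ with $(b_F,\psi)$ a node of $CG_{\mathcal B}(b)$. Then $\mathit{blocked}(b,\phi)=\phi[\vec V_0/\vec V]\wedge\neg\big(\exists\vec V.\bigvee_{\psi\in\mathit{final}(b)}\psi\big)$ (with $\phi$'s variables $V$ renamed to $V_0$); it is satisfiable iff some assignment $\alpha$ of $V_0$ satisfies $\phi[\vec V_0/\vec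 V]$ and, for every $\psi\in\mathit{final}(b)$, no extension of $\alpha$ to $V_0\cup V$ satisfies $\psi$. -}

module Defs where

open import Level using (Level)
open import Data.Nat using (ℕ; _≤_; _∸_; _+_)
open import Data.Fin using (Fin)
open import Data.Bool using (Bool; true; false)
open import Data.Unit using (⊤; tt)
open import Data.Product using (Σ; _×_; _,_; proj₁; proj₂)
open import Data.List using (List; foldr; _++_)
open import Data.List.Relation.Unary.All using (All)
open import Data.List.Relation.Unary.Any using (Any)
open import Relation.Binary.PropositionalEquality using (_≡_; subst)
open import Relation.Nullary using (¬_)
import Data.Integer as ℤ
import Data.Rational as ℚ

data NTy : Set where
  intT ratT : NTy

data Ty : Set where
  boolT : Ty
  num   : NTy → Ty

Num : NTy → Set
Num intT = ℤ.ℤ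
Num ratT = ℚ.ℚ

Val : Ty → Set
Val boolT   = Bool
Val (num s) = Num s

zeroN : ∀ {s} → Num s
zeroN {intT} = ℤ.0ℤ
zeroN {ratT} = ℚ.0ℚ

addN : ∀ {s} → Num s → Num s → Num s
addN {intT} = ℤ._+_
addN {ratT} = ℚ._+_

mulN : ∀ {s} → Num s → Num s → Num s
mulN {intT} = ℤ._*_
mulN {ratT} = ℚ._*_

leN : ∀ {s} → Num s → Num s → Set
leN {intT} = ℤ._≤_
leN {ratT} = ℚ._≤_

ltN : ∀ {s} → Num s → Num s → Set
ltN {intT} = ℤ._<_
ltN {ratT} = ℚ._<_

-- read copy V^r and written copy V^w
data Copy : Set where
  rd wr : Copy

module _ {n : ℕ} (ty : Fin n → Ty) where

  Asg : Set
  Asg = (x : Fin n) → Val (ty x)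

  Env : Set
  Env = Copy → Asg

  record NVar (s : NTy) : Set where
    constructor nvar
    field
      cp    : Copy
      var   : Fin n
      isNum : ty var ≡ num s

  record LinExpr (s : NTy) : Set where
    constructor lin
    field
      const : Num s
      terms : List (Num s × NVar s)

  data Rel : Set where
    neq eq geq gt : Rel

  data Atom : Set where
    bpos bneg : (c : Copy) (x : Fin n) → ty x ≡ boolT → Atom
    cmp       : (s : NTy) → Rel → LinExpr s → LinExpr s → Atom

  Constraint : Set
  Constraint = List Atom

  getNum : ∀ {s} → Asg → (x : Fin n) → ty x ≡ num s → Num s
  getNum α x e = subst Val e (α x)

  getBool : Asg → (x : Fin n) → ty x ≡ boolT → Bool
  getBool α x e = subst Val e (α x)

  evalL : ∀ {s} → Env → LinExpr s → Num s
  evalL β (lin c ts) =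
    addN c (foldr (λ t acc → addN (mulN (proj₁ t) (getNum (β (NVar.cp (proj₂ t))) (NVar.var (proj₂ t)) (NVar.isNum (proj₂ t)))) acc) zeroN ts)

  holdsRel : ∀ {s} → Rel → Num s → Num s → Set
  holdsRel neq a b = ¬ (a ≡ b)
  holdsRel eq  a b = a ≡ b
  holdsRel geq a b = leN b a
  holdsRel gt  a b = ltN b a

  holdsAtom : Env → Atom → Set
  holdsAtom β (bpos c x e) = getBool (β c) x e ≡ true
  holdsAtom β (bneg c x e) = getBool (β c) x e ≡ false
  holdsAtom β (cmp s r e₁ e₂) = holdsRel r (evalL β e₁) (evalL β e₂)

  _⊨_ : Env → Constraint → Set
  β ⊨ g = All (holdsAtom β) g

  occursWAtom : Fin n → Atom → Set
  occursWAtom x (bpos c y _) = (c ≡ wr) × (y ≡ x)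
  occursWAtom x (bneg c y _) = (c ≡ wr) × (y ≡ x)
  occursWAtom x (cmp s r e₁ e₂) =
    Any (λ t → (NVar.cp (proj₂ t) ≡ wr) × (NVar.var (proj₂ t) ≡ x))
        (LinExpr.terms e₁ ++ LinExpr.terms e₂)

  occursW : Constraint → Fin n → Set
  occursW g x = Any (occursWAtom x) g

record DDS {n : ℕ} (ty : Fin n → Ty) (A : Set) : Set₁ where
  field
    B     : Set
    bI    : B
    Δ     : B → A → B → Set
    bF    : B                   -- final states are {bF}
    αI    : Asg ty
    guard : A → Constraint ty

module Sem {n : ℕ} {ty : Fin n → Ty} {A : Set} (𝓑 : DDS ty A) where
  open DDS 𝓑

  write : A → Fin n → Set
  write a x = occursW ty (guard a) x

  Step : B → Asg ty → A → B → Asg ty → Set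
  Step b α a b' α' =
    Δ b a b' ×
    Σ (Env ty) λ β →
      (∀ x → β rd x ≡ α x) ×
      (_⊨_ ty β (guard a)) ×
      (∀ x → (write a x → α' x ≡ β wr x) × (¬ write a x → α' x ≡ α x))

  data Deriv : B → Asg ty → B → Asg ty → Set where
    done : ∀ {b α} → Deriv b α b α
    more : ∀ {b α a b' α' b'' α''} →
           Step b α a b' α' → Deriv b' α' b'' α'' → Deriv b α b'' α''

  Reach : B → Asg ty → Set
  Reach b α = Deriv bI αI b α

  StateReachable : B → Set
  StateReachable b = Σ (Asg ty) (Reach b)

  TransReachable : B → A → B → Set
  TransReachable b a b' =
    Σ (Asg ty) λ α → Reach b α × Σ (Asg ty) λ α' → Step b α a b' α'

  HasBlockedState : Set
  HasBlockedState =
    Σ B λ b → Σ (Asg ty) λ α → Reach b α × ¬ (Σ (Asg ty) λ α' → Deriv b α bF α')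

  -- Constraint graphs.  Formulas are represented semantically: a formula
  -- over V ∪ W (W frozen extra variables, assigned by E) is a predicate.

  Fml : Set → Set₁
  Fml E = E → Asg ty → Set

  envOf : Asg ty → Asg ty → Env ty
  envOf u v rd = u
  envOf u v wr = v

  -- Δ_a (u = V^r, v = V^w)
  ΔA : A → Asg ty → Asg ty → Set
  ΔA a u v = (_⊨_ ty (envOf u v) (guard a)) × (∀ x → ¬ write a x → v x ≡ u x)

  update : ∀ {E} → Fml E → A → Fml E
  update φ a e v = Σ (Asg ty) λ u → φ e u × ΔA a u v

  Sat : ∀ {E} → Fml E → Set
  Sat {E} φ = Σ E λ e → Σ (Asg ty) (φ e)

  _≐_ : ∀ {E} → Fml E → Fml E → Set
  φ ≐ ψ = ∀ e v → (φ e v → ψ e v) × (ψ e v → φ e v)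

  -- nodes of the constraint graph from initial node (b0 , χ)
  -- (formulas taken up to logical equivalence)
  data CGNode {E : Set} (b0 : B) (χ : Fml E) : B → Fml E → Set₁ where
    root : ∀ {φ} → φ ≐ χ → CGNode b0 χ b0 φ
    grow : ∀ {b φ a b' φ'} → CGNode b0 χ b φ → Δ b a b' →
           Sat (update φ a) → φ' ≐ update φ a → CGNode b0 χ b' φ'

  CGEdge : ∀ {E} (b0 : B) (χ : Fml E) → B → Fml E → A → B → Fml E → Set₁
  CGEdge b0 χ b φ a b' φ' =
    CGNode b0 χ b φ × Δ b a b' × Sat (update φ a) × φ' ≐ update φ a

  Cα : Fml ⊤
  Cα _ v = ∀ x → v x ≡ αI x

  Node : B → Fml ⊤ → Set₁
  Node = CGNode bI Cα

  Edge : B → Fml ⊤ → A → B → Fml ⊤ → Set₁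
  Edge = CGEdge bI Cα

  -- CG_𝓑(b), extra variables V₀ assigned by E = Asg
  χ₀ : Fml (Asg ty)
  χ₀ α₀ v = ∀ x → v x ≡ α₀ x

  final : B → Fml (Asg ty) → Set₁
  final b ψ = CGNode b χ₀ bF ψ

  BlockedSat : B → Fml ⊤ → Set₁
  BlockedSat b φ =
    Σ (Asg ty) λ α₀ → φ tt α₀ × (∀ ψ → final b ψ → ¬ Σ (Asg ty) (ψ α₀))

record DPN : Set₁ where
  field
    np nt : ℕ
    A     : Set
    ℓ     : Fin nt → A
    n     : ℕ
    ty    : Fin n → Ty
    pre   : Fin nt → Fin np → ℕ   -- pre t p  = F(p,t)
    post  : Fin nt → Fin np → ℕ   -- post t p = F(t,p)
    guardA : A → Constraint ty    -- guard(t) = guardA (ℓ t)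
    MI MF : Fin np → ℕ
    αI    : Asg ty

module _ (N : DPN) where
  open DPN N

  Marking : Set
  Marking = Fin np → ℕ

  guardT : Fin nt → Constraint ty
  guardT t = guardA (ℓ t)

  netDDS : (Marking → Set) → DDS ty A
  netDDS ok = record
    { B  = Marking
    ; bI = MI
    ; Δ  = λ M a M' → ok M × ok M' ×
             Σ (Fin nt) λ t → (ℓ t ≡ a) × (∀ p → pre t p ≤ M p) ×
               (∀ p → M' p ≡ (M p ∸ pre t p) + post t p)
    ; bF = MF
    ; αI = αI
    ; guard = guardA
    }

  BoundedBy : ℕ → Set
  BoundedBy k = ∀ M α → Sem.Reach (netDDS (λ _ → ⊤)) M α → ∀ p → M p ≤ k

  ddsOf : ℕ → DDS ty A
  ddsOf k = netDDS (λ M → ∀ p → M p ≤ k)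

  _≥M_ : Marking → Marking → Set
  M ≥M M' = ∀ p → M' p ≤ M p

{-# OPTIONS --safe #-}
-- A node (b , φ) of the constraint graph from (b₀ , χ) describes exactly the
-- configurations reachable from models of χ: every model of φ is reached by a
-- derivation ending in b (soundness, since update φ a is the image of φ under
-- one a-step), and every derivation from a model of φ at b continues along
-- graph edges (completeness, since an a-step makes update φ a satisfiable).
-- Each of the three properties is a reachability statement, with blocked
-- states additionally quantifying over derivations to b_F that are tracked by
-- CG(b); so the equivalences hold for every DDS, not only those of bounded DPNs.
module Submission where

open import Defs
open import Data.Nat using (ℕ)
open import Data.Fin using (Fin)
open import Data.Unit using (⊤; tt)
open import Data.Product using (Σ; _×_; _,_; proj₁; proj₂)
open import Data.List using (List; []; _∷_; foldr)
open import Data.List.Relation.Unary.All using ([]; _∷_)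
open import Data.List.Relation.Unary.Any using (Any; here; there)
open import Data.List.Relation.Unary.Any.Properties using (++⁺ˡ; ++⁺ʳ)
open import Relation.Binary.PropositionalEquality
  using (_≡_; refl; sym; trans; cong; cong₂; subst; subst₂)
open import Relation.Nullary using (¬_)
open import Function.Bundles using (_⇔_; mk⇔)

module GuardLocality {n : ℕ} (ty : Fin n → Ty) where

  _≈⟨_⟩_ : Env ty → (Fin n → Set) → Env ty → Set
  β ≈⟨ W ⟩ β' = ∀ c x → (c ≡ wr → W x) → β c x ≡ β' c x

  ≈-anti-mono : ∀ {β β'} {W W' : Fin n → Set} →
                (∀ {x} → W x → W' x) → β ≈⟨ W' ⟩ β' → β ≈⟨ W ⟩ β'
  ≈-anti-mono W⊆W' agree c x w = agree c x (λ c≡wr → W⊆W' (w c≡wr))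

  Terms : NTy → Set
  Terms s = List (Num s × NVar ty s)

  OccursWIn : ∀ {s} → Terms s → Fin n → Set
  OccursWIn ts x = Any (λ t → (NVar.cp (proj₂ t) ≡ wr) × (NVar.var (proj₂ t) ≡ x)) ts

  sumTerms : ∀ {s} → Env ty → Terms s → Num s
  sumTerms β ts = foldr (λ t acc → addN (mulN (proj₁ t)
    (getNum ty (β (NVar.cp (proj₂ t))) (NVar.var (proj₂ t)) (NVar.isNum (proj₂ t)))) acc) zeroN ts

  sumTerms-cong : ∀ {s β β'} (ts : Terms s) → β ≈⟨ OccursWIn ts ⟩ β' →
                  sumTerms β ts ≡ sumTerms β' ts
  sumTerms-cong [] agree = refl
  sumTerms-cong ((q , nvar c x e) ∷ ts) agree =
    cong₂ addN (cong (λ v → mulN q (subst Val e v)) (agree c x (λ c≡wr → here (c≡wr , refl))))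
               (sumTerms-cong ts (≈-anti-mono there agree))

  holdsAtom-transfer : ∀ {β β'} (at : Atom ty) → β ≈⟨ (λ x → occursWAtom ty x at) ⟩ β' →
                       holdsAtom ty β at → holdsAtom ty β' at
  holdsAtom-transfer (bpos c x e) agree h = trans (cong (subst Val e) (sym (agree c x (λ c≡wr → c≡wr , refl)))) h
  holdsAtom-transfer (bneg c x e) agree h = trans (cong (subst Val e) (sym (agree c x (λ c≡wr → c≡wr , refl)))) h
  holdsAtom-transfer (cmp s r (lin c₁ ts₁) (lin c₂ ts₂)) agree =
    subst₂ (holdsRel ty r)
      (cong (addN c₁) (sumTerms-cong ts₁ (≈-anti-mono ++⁺ˡ agree)))
      (cong (addN c₂) (sumTerms-cong ts₂ (≈-anti-mono (++⁺ʳ ts₁) agree)))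

  ⊨-transfer : ∀ {β β'} (g : Constraint ty) → β ≈⟨ occursW ty g ⟩ β' →
               _⊨_ ty β g → _⊨_ ty β' g
  ⊨-transfer []       agree []       = []
  ⊨-transfer (at ∷ g) agree (h ∷ hs) =
    holdsAtom-transfer at (≈-anti-mono here agree) h ∷ ⊨-transfer g (≈-anti-mono there agree) hs

module ConstraintGraph {n : ℕ} {ty : Fin n → Ty} {A : Set} (𝓑 : DDS ty A) where
  open DDS 𝓑
  open Sem 𝓑
  open GuardLocality ty

  ≐-refl : ∀ {E} (φ : Fml E) → φ ≐ φ
  ≐-refl φ e v = (λ h → h) , (λ h → h)

  step⇒ΔA : ∀ {b α a b' α'} → Step b α a b' α' → ΔA a α α'
  step⇒ΔA {α = α} {a} {α' = α'} (_ , β , β-rd , β⊨guard , β-wr) =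
    ⊨-transfer (guard a) agree β⊨guard , (λ x ¬w → proj₂ (β-wr x) ¬w)
    where
    agree : β ≈⟨ write a ⟩ envOf α α'
    agree rd x _ = β-rd x
    agree wr x w = sym (proj₁ (β-wr x) (w refl))

  ΔA⇒step : ∀ {b α a b' u v} → (∀ x → α x ≡ u x) → Δ b a b' → ΔA a u v → Step b α a b' v
  ΔA⇒step {u = u} {v} α≡u δ (u,v⊨guard , frame) =
    δ , envOf u v , (λ x → sym (α≡u x)) , u,v⊨guard ,
    (λ x → (λ _ → refl) , (λ ¬w → trans (frame x ¬w) (sym (α≡u x))))

  Deriv-snoc : ∀ {b α b₁ α₁ a b₂ α₂} → Deriv b α b₁ α₁ → Step b₁ α₁ a b₂ α₂ → Deriv b α b₂ α₂
  Deriv-snoc done        s = more s done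
  Deriv-snoc (more s₁ d) s = more s₁ (Deriv-snoc d s)

  CGNode-satisfiable : ∀ {E b₀} {χ : Fml E} {b φ} → Sat χ → CGNode b₀ χ b φ → Sat φ
  CGNode-satisfiable (e , u , χeu) (root φ≐χ)               = e , u , proj₂ (φ≐χ e u) χeu
  CGNode-satisfiable _ (grow _ _ (e , v , upd) φ'≐update) = e , v , proj₂ (φ'≐update e v) upd

  CGNode-sound : ∀ {E b₀} {χ : Fml E} (α₀ : E → Asg ty) → (∀ e u → χ e u → ∀ x → α₀ e x ≡ u x) →
                 ∀ {b φ} → CGNode b₀ χ b φ → ∀ e u → φ e u →
                 Σ (Asg ty) λ α → Deriv b₀ (α₀ e) b α × (∀ x → α x ≡ u x)
  CGNode-sound α₀ χ⇒α₀ (root φ≐χ) e u φeu = α₀ e , done , χ⇒α₀ e u (proj₁ (φ≐χ e u) φeu)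
  CGNode-sound α₀ χ⇒α₀ (grow node δ _ φ'≐update) e v φ'ev
    with proj₁ (φ'≐update e v) φ'ev
  ... | u , φeu , Δuv with CGNode-sound α₀ χ⇒α₀ node e u φeu
  ... | α , d , α≡u = v , Deriv-snoc d (ΔA⇒step α≡u δ Δuv) , (λ _ → refl)

  CGNode-complete : ∀ {E b₀} {χ : Fml E} {b₁ α₁ b₂ α₂} → Deriv b₁ α₁ b₂ α₂ →
                    ∀ {φ} → CGNode b₀ χ b₁ φ → ∀ e → φ e α₁ →
                    Σ (Fml E) λ φ₂ → CGNode b₀ χ b₂ φ₂ × φ₂ e α₂
  CGNode-complete done node e φeα = _ , node , φeα
  CGNode-complete (more {a = a} {α' = α'} s d) {φ} node e φeα =
    CGNode-complete d (grow node (proj₁ s) (e , α' , upd) (≐-refl (update φ a))) e upd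
    where
    upd : update φ a e α'
    upd = _ , φeα , step⇒ΔA s

  node⇒reach : ∀ {b φ u} → Node b φ → φ tt u → Σ (Asg ty) λ α → Reach b α × (∀ x → α x ≡ u x)
  node⇒reach node = CGNode-sound (λ _ → αI) (λ _ _ Cαu x → sym (Cαu x)) node tt _

  reach⇒node : ∀ {b α} → Reach b α → Σ (Fml ⊤) λ φ → Node b φ × φ tt α
  reach⇒node r = CGNode-complete r (root (≐-refl Cα)) tt (λ _ → refl)

  final⇒deriv : ∀ {b ψ α₀ v} → final b ψ → ψ α₀ v → Σ (Asg ty) (Deriv b α₀ bF)
  final⇒deriv fin ψv with CGNode-sound (λ α₀ → α₀) (λ _ _ χ₀u x → sym (χ₀u x)) fin _ _ ψv
  ... | α , d , _ = α , d

  deriv⇒final : ∀ {b α₀ u α} → (∀ x → u x ≡ α₀ x) → Deriv b u bF α →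
                Σ (Fml (Asg ty)) λ ψ → final b ψ × ψ α₀ α
  deriv⇒final u≡α₀ d = CGNode-complete d (root (≐-refl χ₀)) _ u≡α₀

  blocked-node⇔blocked-state :
    (Σ B λ b → Σ (Fml ⊤) λ φ → Node b φ × ¬ (b ≡ bF) × BlockedSat b φ) ⇔ HasBlockedState
  blocked-node⇔blocked-state = mk⇔ to from
    where
    to : (Σ B λ b → Σ (Fml ⊤) λ φ → Node b φ × ¬ (b ≡ bF) × BlockedSat b φ) → HasBlockedState
    to (b , φ , node , _ , α₀ , φα₀ , no-final) with node⇒reach node φα₀
    ... | α , r , α≡α₀ = b , α , r , λ (α' , d) →
      let (ψ , fin , ψα') = deriv⇒final α≡α₀ d in no-final ψ fin (α' , ψα')
    from : HasBlockedState → Σ B λ b → Σ (Fml ⊤) λ φ → Node b φ × ¬ (b ≡ bF) × BlockedSat b φ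
    from (b , α , r , stuck) with reach⇒node r
    ... | φ , node , φα =
      b , φ , node , (λ { refl → stuck (α , done) }) , α , φα ,
      λ ψ fin (_ , ψv) → stuck (final⇒deriv fin ψv)

  silent-label⇔unreachable-label : (T : Set) (ℓ : T → A) →
    (Σ T λ t → ¬ (Σ B λ b → Σ (Fml ⊤) λ φ → Σ B λ b' → Σ (Fml ⊤) λ φ' → Edge b φ (ℓ t) b' φ'))
    ⇔ (Σ T λ t → ∀ (b b' : B) → ¬ TransReachable b (ℓ t) b')
  silent-label⇔unreachable-label T ℓ = mk⇔ to from
    where
    to : (Σ T λ t → ¬ (Σ B λ b → Σ (Fml ⊤) λ φ → Σ B λ b' → Σ (Fml ⊤) λ φ' → Edge b φ (ℓ t) b' φ')) →
         Σ T λ t → ∀ (b b' : B) → ¬ TransReachable b (ℓ t) b'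
    to (t , no-edge) = t , λ b b' (α , r , α' , s) →
      let (φ , node , φα) = reach⇒node r
      in no-edge (b , φ , b' , update φ (ℓ t) , node , proj₁ s ,
                  (tt , α' , α , φα , step⇒ΔA s) , ≐-refl (update φ (ℓ t)))
    from : (Σ T λ t → ∀ (b b' : B) → ¬ TransReachable b (ℓ t) b') →
           Σ T λ t → ¬ (Σ B λ b → Σ (Fml ⊤) λ φ → Σ B λ b' → Σ (Fml ⊤) λ φ' → Edge b φ (ℓ t) b' φ')
    from (t , unreachable) = t , λ (b , φ , b' , _ , node , δ , (_ , v , u , φu , Δuv) , _) →
      let (α , r , α≡u) = node⇒reach node φu
      in unreachable b b' (α , r , v , ΔA⇒step α≡u δ Δuv)

  node⇔reachable-state : (P : B → Set) →
    (Σ B λ b → Σ (Fml ⊤) λ φ → Node b φ × P b) ⇔ (Σ B λ b → P b × StateReachable b)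
  node⇔reachable-state P = mk⇔ to from
    where
    to : (Σ B λ b → Σ (Fml ⊤) λ φ → Node b φ × P b) → Σ B λ b → P b × StateReachable b
    to (b , φ , node , Pb) with CGNode-satisfiable (tt , αI , λ _ → refl) node
    ... | _ , _ , φu with node⇒reach node φu
    ... | α , r , _ = b , Pb , α , r
    from : (Σ B λ b → P b × StateReachable b) → Σ B λ b → Σ (Fml ⊤) λ φ → Node b φ × P b
    from (b , Pb , α , r) with reach⇒node r
    ... | φ , node , _ = b , φ , node , Pb

theorem1 : (N : DPN) (k : ℕ) → BoundedBy N k →
  let open DPN N
      open Sem (ddsOf N k)
  in
  ((Σ (Marking N) λ b → Σ (Fml ⊤) λ φ → Node b φ × ¬ (b ≡ MF) × BlockedSat b φ)
     ⇔ HasBlockedState)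
  ×
  ((Σ (Fin nt) λ t → ¬ (Σ (Marking N) λ b → Σ (Fml ⊤) λ φ → Σ (Marking N) λ b' → Σ (Fml ⊤) λ φ' → Edge b φ (ℓ t) b' φ'))
     ⇔ (Σ (Fin nt) λ t → ∀ (b b' : Marking N) → ¬ TransReachable b (ℓ t) b'))
  ×
  ((Σ (Marking N) λ b → Σ (Fml ⊤) λ φ → Node b φ × _≥M_ N b MF)
     ⇔ (Σ (Marking N) λ b → _≥M_ N b MF × StateReachable b))
theorem1 N k _ =
  blocked-node⇔blocked-state ,
  silent-label⇔unreachable-label (Fin nt) ℓ ,
  node⇔reachable-state (λ M → _≥M_ N M MF)
  where
  open DPN N
  open ConstraintGraph (ddsOf N k)
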